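{- Let $G$ be the path graph on vertices $v_1,\ldots,v_n$ (in this order), let $k\geq2$ and $n\geq k+2$, and let $L$ be an NL-landmark set for parameter $k$ with $|L|=k$. If $L$ induces at least two gaps, then the set of the $n-k$ holes is of the form $\{v_i,v_{i+\rho},v_{i+2\rho},\ldots,v_{i+(n-k-1)\rho}\}$ where $\rho\geq3$ is odd, $i\geq1$, and $i+(n-k-1)\rho\leq n$. In particular, if $G$ has an NL-landmark set for parameter $k$ with exactly $k$ vertices that induces at least two gaps, then $n\leq 3k/2+1$.
   Context: $d(x,y)$ denotes the graph distance. A vertex $\tau$ separates distinct vertices $u,v$ if $d(u,\tau)\neq d(v,\tau)$. A set $L\subseteq V$ is an NL-landmark set for parameter $k$ if every pair of distinct vertices $u,v\in V\setminus L$ is separated by at least $k$ distinct vertices of $L$. Given $L$, a hole is a vertex of $V\setminus L$, and a gap is a maximal sequence of consecutive holes along the path. -}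

module Defs where

open import Data.Nat using (ℕ; zero; suc; _+_; _*_; _∸_; _≤_; _<_; ∣_-_∣)
open import Data.Fin using (Fin; toℕ)
open import Data.Fin.Subset using (Subset; _∈_; _∉_; _⊆_; ∣_∣)
open import Data.Product using (Σ; _×_; ∃-syntax)
open import Relation.Nullary using (¬_)
open import Relation.Binary.PropositionalEquality using (_≡_; _≢_)

-- Path graph P_n: vertex v_j (1 ≤ j ≤ n) is represented by the element of Fin n
-- with toℕ = j - 1.  Graph distance in the path is |i - j|.
dist : {n : ℕ} → Fin n → Fin n → ℕ
dist u v = ∣ toℕ u - toℕ v ∣

Separates : {n : ℕ} → Fin n → Fin n → Fin n → Set
Separates τ u v = dist u τ ≢ dist v τ

IsNLLandmarkSet : (n k : ℕ) → Subset n → Set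
IsNLLandmarkSet n k L =
  (u v : Fin n) → u ∉ L → v ∉ L → u ≢ v →
  ∃[ S ] (S ⊆ L × k ≤ ∣ S ∣ × ((τ : Fin n) → τ ∈ S → Separates τ u v))

HoleAt : {n : ℕ} → Subset n → ℕ → Set
HoleAt {n} L m = ∃[ v ] (toℕ v ≡ m × v ∉ L)

IsGap : {n : ℕ} → Subset n → ℕ → ℕ → Set
IsGap L a b =
  a ≤ b
  × ((m : ℕ) → a ≤ m → m ≤ b → HoleAt L m)
  × ((a' : ℕ) → a ≡ suc a' → ¬ HoleAt L a')
  × ¬ HoleAt L (suc b)

AtLeastTwoGaps : {n : ℕ} → Subset n → Set
AtLeastTwoGaps L =
  ∃[ a ] ∃[ b ] ∃[ a' ] ∃[ b' ]
    (IsGap L a b × IsGap L a' b' × ¬ (a ≡ a' × b ≡ b'))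

-- Since |L| = k, the k landmarks separating two holes must be all of L: every landmark separates
-- every two holes. On a path a vertex is equidistant from two others exactly when it is their
-- midpoint, so the hole positions are closed under midpoints. Hence consecutive holes are an odd
-- distance apart (otherwise their midpoint would be a hole between them), and for three consecutive
-- holes x < y < z the midpoint of x and z is a hole strictly between them, i.e. it is y. The holes
-- therefore form an arithmetic progression with odd step ρ, and ρ ≠ 1 because some landmark lies
-- between two holes. Fitting n - k terms with step at least 3 into n positions gives 2n ≤ 3k + 2.
module Submission where

open import Defs
open import Data.Bool using (Bool; true; false)
open import Data.Bool.Properties using (not-¬; ¬-not)
open import Data.Fin using (Fin; toℕ; fromℕ<)
open import Data.Fin.Properties using (toℕ-fromℕ<)
open import Data.Fin.Subset using (Subset; inside; outside; _∈_; _∉_; ∣_∣)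
open import Data.Fin.Subset.Properties using (_∈?_; p⊂q⇒∣p∣<∣q∣)
open import Data.Nat using (ℕ; zero; suc; _+_; _*_; _∸_; _≤_; _<_; _%_; z≤n; s≤s; z<s; ∣_-_∣; _≤?_)
open import Data.Nat.DivMod using ([m+kn]%n≡m%n)
open import Data.Nat.Properties
open import Data.Nat.Tactic.RingSolver using (solve-∀)
open import Data.Product using (_×_; ∃-syntax; _,_)
open import Data.Sum using (_⊎_; inj₁; inj₂)
open import Data.Vec using ([]; _∷_; here; there)
open import Function using (_∘_)
open import Function.Bundles using (_⇔_; mk⇔; Equivalence)
open import Relation.Binary.Definitions using (tri<; tri≈; tri>)
open import Relation.Binary.PropositionalEquality
open import Relation.Nullary using (¬_; yes; no; contradiction)

even⊎odd : ∀ d → ∃[ h ] (d ≡ h * 2 ⊎ d ≡ suc (h * 2))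
even⊎odd zero = 0 , inj₁ refl
even⊎odd (suc d) with even⊎odd d
... | h , inj₁ refl = h , inj₂ refl
... | h , inj₂ refl = suc h , inj₁ refl

midpoint<right : ∀ {u v c} → u < v → u + v ≡ c + c → c < v
midpoint<right u<v eq = ≰⇒> λ v≤c → <-irrefl eq (+-mono-<-≤ (<-≤-trans u<v v≤c) v≤c)

equidistant-from-lower : ∀ {u v c} → u ≤ c → u + v ≡ c + c → ∣ u - c ∣ ≡ ∣ v - c ∣
equidistant-from-lower {u} {v} u≤c eq with m≤n⇒∃[o]m+o≡n u≤c
... | e , refl = begin
  ∣ u - u + e ∣          ≡⟨ ∣m-m+n∣≡n u e ⟩
  e                      ≡⟨ ∣m-m+n∣≡n (u + e) e ⟨
  ∣ u + e - u + e + e ∣  ≡⟨ ∣-∣-comm (u + e) (u + e + e) ⟩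
  ∣ u + e + e - u + e ∣  ≡⟨ cong ∣_- u + e ∣ v≡u+e+e ⟨
  ∣ v - u + e ∣          ∎
  where
  open ≡-Reasoning
  double : ∀ u e → (u + e) + (u + e) ≡ u + (u + e + e)
  double = solve-∀
  v≡u+e+e : v ≡ u + e + e
  v≡u+e+e = +-cancelˡ-≡ u v (u + e + e) (trans eq (double u e))

midpoint-equidistant : ∀ {u v c} → u + v ≡ c + c → ∣ u - c ∣ ≡ ∣ v - c ∣
midpoint-equidistant {u} {v} {c} eq with ≤-total u c
... | inj₁ u≤c = equidistant-from-lower u≤c eq
... | inj₂ c≤u = sym (equidistant-from-lower v≤c (trans (+-comm v u) eq))
  where
  v≤c : v ≤ c
  v≤c = +-cancelˡ-≤ c v c (subst (c + v ≤_) eq (+-monoˡ-≤ v c≤u))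

indicator : Bool → ℕ
indicator true = 1
indicator false = 0

countBelow : (ℕ → Bool) → ℕ → ℕ
countBelow P zero = 0
countBelow P (suc N) = indicator (P 0) + countBelow (P ∘ suc) N

countBelow-suc : ∀ P N → countBelow P (suc N) ≡ countBelow P N + indicator (P N)
countBelow-suc P zero = +-comm (indicator (P 0)) 0
countBelow-suc P (suc N) = trans (cong (indicator (P 0) +_) (countBelow-suc (P ∘ suc) N))
  (sym (+-assoc (indicator (P 0)) _ _))

countBelow-skip : ∀ P {lo hi} → lo ≤ hi → (∀ {m} → lo ≤ m → m < hi → P m ≡ false) →
  countBelow P hi ≡ countBelow P lo
countBelow-skip P {hi = zero} z≤n _ = refl
countBelow-skip P {lo} {suc hi} lo≤1+hi none with m≤n⇒m<n∨m≡n lo≤1+hi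
... | inj₂ refl = refl
... | inj₁ (s≤s lo≤hi) = begin
  countBelow P (suc hi)              ≡⟨ countBelow-suc P hi ⟩
  countBelow P hi + indicator (P hi) ≡⟨ cong (λ b → countBelow P hi + indicator b) (none lo≤hi ≤-refl) ⟩
  countBelow P hi + 0                ≡⟨ +-identityʳ _ ⟩
  countBelow P hi                    ≡⟨ countBelow-skip P lo≤hi none-below-hi ⟩
  countBelow P lo                    ∎
  where
  open ≡-Reasoning
  none-below-hi : ∀ {m} → lo ≤ m → m < hi → P m ≡ false
  none-below-hi lo≤m m<hi = none lo≤m (m<n⇒m<1+n m<hi)

IsArithmeticProgression : (ℕ → Bool) → (a ρ N : ℕ) → Set
IsArithmeticProgression P a ρ N = ∀ m → P m ≡ true ⇔ (∃[ t ] (t < N × m ≡ a + t * ρ))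

unit-step⇒interval : ∀ {P a N u w v} → IsArithmeticProgression P a 1 N →
  P u ≡ true → P v ≡ true → u ≤ w → w ≤ v → P w ≡ true
unit-step⇒interval {a = a} {w = w} progression Pu Pv u≤w w≤v
  with Equivalence.to (progression _) Pu | Equivalence.to (progression _) Pv
... | t₁ , _ , refl | t₂ , t₂<N , refl with m≤n⇒∃[o]m+o≡n (≤-trans (m≤m+n a (t₁ * 1)) u≤w)
... | s , refl = Equivalence.from (progression (a + s)) (s , s<N , cong (a +_) (sym (*-identityʳ s)))
  where
  s<N = ≤-<-trans (+-cancelˡ-≤ a s t₂ (subst (λ t → a + s ≤ a + t) (*-identityʳ t₂) w≤v)) t₂<N

module MidpointConvex
  (P : ℕ → Bool) (n : ℕ)
  (bounded : ∀ {m} → P m ≡ true → m < n)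
  (convex : ∀ {u v c} → u < v → P u ≡ true → P v ≡ true → u + v ≡ c + c → P c ≡ true)
  where

  NoneFrom : ℕ → Set
  NoneFrom lo = ∀ {m} → lo ≤ m → P m ≡ false

  FirstFrom : ℕ → Set
  FirstFrom lo = ∃[ z ] (lo ≤ z × P z ≡ true × (∀ {m} → lo ≤ m → m < z → P m ≡ false))

  false-at-or-beyond : ∀ {lo m} → P lo ≡ false → lo ≤ m → (lo < m → P m ≡ false) → P m ≡ false
  false-at-or-beyond Plo lo≤m later with m≤n⇒m<n∨m≡n lo≤m
  ... | inj₁ lo<m = later lo<m
  ... | inj₂ refl = Plo

  firstWithin : ∀ d lo → (∀ {m} → lo ≤ m → m < d + lo → P m ≡ false) ⊎ FirstFrom lo
  firstWithin zero lo = inj₁ λ lo≤m m<lo → contradiction lo≤m (<⇒≱ m<lo)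
  firstWithin (suc d) lo with P lo in Plo
  ... | true = inj₂ (lo , ≤-refl , Plo , λ lo≤m m<lo → contradiction lo≤m (<⇒≱ m<lo))
  ... | false with firstWithin d (suc lo)
  ...   | inj₁ none = inj₁ λ {m} lo≤m m<1+d+lo →
          false-at-or-beyond Plo lo≤m λ lo<m → none lo<m (subst (m <_) (sym (+-suc d lo)) m<1+d+lo)
  ...   | inj₂ (z , lo<z , Pz , least) = inj₂ (z , <⇒≤ lo<z , Pz , λ lo≤m m<z →
          false-at-or-beyond Plo lo≤m λ lo<m → least lo<m m<z)

  firstFrom : ∀ lo → NoneFrom lo ⊎ FirstFrom lo
  firstFrom lo with firstWithin n lo
  ... | inj₂ first = inj₂ first
  ... | inj₁ none = inj₁ λ {m} lo≤m →
          ¬-not λ Pm → not-¬ Pm (none lo≤m (<-≤-trans (bounded Pm) (m≤m+n n lo)))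

  record Consecutive (x y : ℕ) : Set where
    field
      x<y     : x < y
      left    : P x ≡ true
      right   : P y ≡ true
      between : ∀ {m} → x < m → m < y → P m ≡ false

  open Consecutive

  nextMember : ∀ {x} → P x ≡ true → NoneFrom (suc x) ⊎ ∃[ y ] Consecutive x y
  nextMember {x} Px with firstFrom (suc x)
  ... | inj₁ none = inj₁ none
  ... | inj₂ (y , x<y , Py , least) =
        inj₂ (y , record { x<y = x<y ; left = Px ; right = Py ; between = least })

  consecutive-gap-odd : ∀ {x y} → Consecutive x y → ∃[ r ] y ≡ x + suc (r * 2)
  consecutive-gap-odd {x} c with m≤n⇒∃[o]m+o≡n (<⇒≤ (x<y c))
  ... | d , refl with even⊎odd d
  ...   | r , inj₂ refl = r , refl
  ...   | zero , inj₁ refl = contradiction (x<y c) (<-irrefl (sym (+-identityʳ x)))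
  ...   | suc h , inj₁ refl =
          contradiction (between c x<mid mid<y) (not-¬ (convex (x<y c) (left c) (right c) (double x h)))
    where
    double : ∀ x h → x + (x + suc h * 2) ≡ (x + suc h) + (x + suc h)
    double = solve-∀
    x<mid : x < x + suc h
    x<mid = m<m+n x z<s
    mid<y : x + suc h < x + suc h * 2
    mid<y = +-monoʳ-< x (s≤s (s≤s (m≤m*n h 2)))

  sole-member-between : ∀ {x y z m} → Consecutive x y → Consecutive y z →
    x < m → m < z → P m ≡ true → m ≡ y
  sole-member-between {y = y} {m = m} c₁ c₂ x<m m<z Pm with <-cmp m y
  ... | tri< m<y _ _ = contradiction (between c₁ x<m m<y) (not-¬ Pm)
  ... | tri≈ _ m≡y _ = m≡y
  ... | tri> _ _ y<m = contradiction (between c₂ y<m m<z) (not-¬ Pm)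

  consecutive-midpoint : ∀ {x y z} → Consecutive x y → Consecutive y z → x + z ≡ y + y
  consecutive-midpoint {x} c₁ c₂ with consecutive-gap-odd c₁
  ... | r , refl with consecutive-gap-odd c₂
  ...   | s , refl = begin
    x + z      ≡⟨ double x r s ⟩
    mid + mid  ≡⟨ cong₂ _+_ mid≡y mid≡y ⟩
    y + y      ∎
    where
    open ≡-Reasoning
    y = x + suc (r * 2)
    z = x + suc (r * 2) + suc (s * 2)
    mid = x + suc (r + s)
    double : ∀ x r s → x + (x + suc (r * 2) + suc (s * 2)) ≡ (x + suc (r + s)) + (x + suc (r + s))
    double = solve-∀
    split : ∀ x r s → x + suc (r * 2) + suc (s * 2) ≡ (x + suc (r + s)) + suc (r + s)
    split = solve-∀
    mid<z : mid < z
    mid<z = subst (mid <_) (sym (split x r s)) (m<m+n mid z<s)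
    mid≡y : mid ≡ y
    mid≡y = sole-member-between c₁ c₂ (m<m+n x z<s) mid<z
      (convex (<-trans (m<m+n x z<s) mid<z) (left c₁) (right c₂) (double x r s))

  countBelow-consecutive : ∀ {x y} → Consecutive x y → countBelow P (suc y) ≡ suc (countBelow P (suc x))
  countBelow-consecutive {x} {y} c = begin
    countBelow P (suc y)             ≡⟨ countBelow-suc P y ⟩
    countBelow P y + indicator (P y) ≡⟨ cong (λ b → countBelow P y + indicator b) (right c) ⟩
    countBelow P y + 1               ≡⟨ +-comm _ 1 ⟩
    suc (countBelow P y)             ≡⟨ cong suc (countBelow-skip P (x<y c) (between c)) ⟩
    suc (countBelow P (suc x))       ∎
    where open ≡-Reasoning

  module Progression
    (a ρ : ℕ) (noneBelow : ∀ {m} → m < a → P m ≡ false) (firstGap : Consecutive a (a + ρ))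
    where

    term : ℕ → ℕ
    term zero = a
    term (suc t) = term t + ρ

    term≡ : ∀ t → term t ≡ a + t * ρ
    term≡ zero = sym (+-identityʳ a)
    term≡ (suc t) = trans (cong (_+ ρ) (term≡ t)) (shift a t ρ)
      where
      shift : ∀ a t ρ → a + t * ρ + ρ ≡ a + suc t * ρ
      shift = solve-∀

    0<ρ : 0 < ρ
    0<ρ = +-cancelˡ-< a 0 ρ (subst (_< a + ρ) (sym (+-identityʳ a)) (x<y firstGap))

    t<term[1+t] : ∀ t → t < term (suc t)
    t<term[1+t] zero = <-≤-trans 0<ρ (m≤n+m ρ a)
    t<term[1+t] (suc t) =
      subst (_≤ term (suc t) + ρ) (+-comm (suc t) 1) (+-mono-≤ (t<term[1+t] t) 0<ρ)

    record Prefix (j : ℕ) : Set where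
      field
        members     : ∀ {t} → t ≤ suc j → P (term t) ≡ true
        onlyMembers : ∀ {m} → m ≤ term (suc j) → P m ≡ true → ∃[ t ] (t ≤ suc j × m ≡ term t)
        lastGap     : Consecutive (term j) (term (suc j))
        counted     : countBelow P (suc (term (suc j))) ≡ suc (suc j)

    open Prefix

    prefix₀ : Prefix 0
    prefix₀ = record
      { members = λ { z≤n → left firstGap ; (s≤s z≤n) → right firstGap }
      ; onlyMembers = onlyMembers₀
      ; lastGap = firstGap
      ; counted = trans (countBelow-consecutive firstGap) (cong suc count-a)
      }
      where
      onlyMembers₀ : ∀ {m} → m ≤ a + ρ → P m ≡ true → ∃[ t ] (t ≤ 1 × m ≡ term t)
      onlyMembers₀ {m} m≤a+ρ Pm with <-cmp m a
      ... | tri< m<a _ _ = contradiction (noneBelow m<a) (not-¬ Pm)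
      ... | tri≈ _ m≡a _ = 0 , z≤n , m≡a
      ... | tri> _ _ a<m with m≤n⇒m<n∨m≡n m≤a+ρ
      ...   | inj₁ m<a+ρ = contradiction (between firstGap a<m m<a+ρ) (not-¬ Pm)
      ...   | inj₂ m≡a+ρ = 1 , ≤-refl , m≡a+ρ
      count-a : countBelow P (suc a) ≡ 1
      count-a = trans (countBelow-suc P a)
        (cong₂ (λ c b → c + indicator b) (countBelow-skip P z≤n (λ _ → noneBelow)) (left firstGap))

    nextTerm : ∀ {j z} → Consecutive (term j) (term (suc j)) → Consecutive (term (suc j)) z →
      z ≡ term (suc (suc j))
    nextTerm {j} {z} c₁ c₂ =
      +-cancelˡ-≡ (term j) z _ (trans (consecutive-midpoint c₁ c₂) (double (term j) ρ))
      where
      double : ∀ x ρ → (x + ρ) + (x + ρ) ≡ x + (x + ρ + ρ)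
      double = solve-∀

    grow : ∀ {j} → Prefix j → Consecutive (term (suc j)) (term (suc (suc j))) → Prefix (suc j)
    grow {j} pre gap = record
      { members = members′
      ; onlyMembers = onlyMembers′
      ; lastGap = gap
      ; counted = trans (countBelow-consecutive gap) (cong suc (counted pre))
      }
      where
      members′ : ∀ {t} → t ≤ suc (suc j) → P (term t) ≡ true
      members′ t≤2+j with m≤n⇒m<n∨m≡n t≤2+j
      ... | inj₁ (s≤s t≤1+j) = members pre t≤1+j
      ... | inj₂ refl = right gap
      onlyMembers′ : ∀ {m} → m ≤ term (suc (suc j)) → P m ≡ true →
        ∃[ t ] (t ≤ suc (suc j) × m ≡ term t)
      onlyMembers′ {m} m≤last Pm with m ≤? term (suc j)
      ... | yes m≤ = let (t , t≤ , m≡) = onlyMembers pre m≤ Pm in t , m≤n⇒m≤1+n t≤ , m≡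
      ... | no m≰ with m≤n⇒m<n∨m≡n m≤last
      ...   | inj₁ m<last = contradiction (between gap (≰⇒> m≰) m<last) (not-¬ Pm)
      ...   | inj₂ m≡last = suc (suc j) , ≤-refl , m≡last

    extend : ∀ {j} → Prefix j → NoneFrom (suc (term (suc j))) ⊎ Prefix (suc j)
    extend {j} pre with nextMember (members pre ≤-refl)
    ... | inj₁ none = inj₁ none
    ... | inj₂ (z , gap) with nextTerm {j} (lastGap pre) gap
    ...   | refl = inj₂ (grow pre gap)

    Complete : Set
    Complete = ∃[ J ] (Prefix J × NoneFrom (suc (term (suc J))))

    prefixOrComplete : ∀ j → Prefix j ⊎ Complete
    prefixOrComplete zero = inj₁ prefix₀
    prefixOrComplete (suc j) with prefixOrComplete j
    ... | inj₂ done = inj₂ done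
    ... | inj₁ pre with extend pre
    ...   | inj₁ none = inj₂ (j , pre , none)
    ...   | inj₂ pre′ = inj₁ pre′

    complete : Complete
    complete with prefixOrComplete n
    ... | inj₂ done = done
    ... | inj₁ pre = contradiction (bounded (members pre ≤-refl)) (<⇒≯ (t<term[1+t] n))

    progression : ∃[ M ] (IsArithmeticProgression P a ρ (suc M) × countBelow P n ≡ suc M)
    progression with complete
    ... | J , pre , none = suc J , (λ m → mk⇔ to (from m)) , count
      where
      to : ∀ {m} → P m ≡ true → ∃[ t ] (t < suc (suc J) × m ≡ a + t * ρ)
      to {m} Pm with m ≤? term (suc J)
      ... | yes m≤ = let (t , t≤ , m≡) = onlyMembers pre m≤ Pm in t , s≤s t≤ , trans m≡ (term≡ t)
      ... | no m≰ = contradiction (none (≰⇒> m≰)) (not-¬ Pm)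
      from : ∀ m → ∃[ t ] (t < suc (suc J) × m ≡ a + t * ρ) → P m ≡ true
      from m (t , s≤s t≤ , m≡) =
        subst (λ q → P q ≡ true) (trans (term≡ t) (sym m≡)) (members pre t≤)
      count : countBelow P n ≡ suc (suc J)
      count = trans (countBelow-skip P (bounded (members pre ≤-refl)) (λ after _ → none after))
        (counted pre)

  progression-around-gap : ∀ {u w v} → u < w → w < v → P u ≡ true → P w ≡ false → P v ≡ true →
    ∃[ a ] ∃[ ρ ] ∃[ M ]
      (3 ≤ ρ × ρ % 2 ≡ 1 × IsArithmeticProgression P a ρ (suc M) × countBelow P n ≡ suc M)
  progression-around-gap {v = v} u<w w<v Pu Pw Pv with firstFrom 0
  ... | inj₁ none = contradiction (none z≤n) (not-¬ Pu)
  ... | inj₂ (a , _ , Pa , least) with nextMember Pa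
  ...   | inj₁ none = contradiction (none a<v) (not-¬ Pv)
    where
    a<v : a < v
    a<v = ≤-<-trans (≮⇒≥ λ u<a → not-¬ Pu (least z≤n u<a)) (<-trans u<w w<v)
  ...   | inj₂ (b , firstGap) with consecutive-gap-odd firstGap
  ...     | r , refl with Progression.progression a (suc (r * 2)) (least z≤n) firstGap
  ...       | M , isProgression , count =
              a , suc (r * 2) , M , 3≤ρ r isProgression , [m+kn]%n≡m%n 1 r 2 , isProgression , count
    where
    3≤ρ : ∀ r → IsArithmeticProgression P a (suc (r * 2)) (suc M) → 3 ≤ suc (r * 2)
    3≤ρ zero prog = contradiction Pw (not-¬ (unit-step⇒interval prog Pu Pv (<⇒≤ u<w) (<⇒≤ w<v)))
    3≤ρ (suc _) _ = s≤s (s≤s (s≤s z≤n))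

isHole : ∀ {n} → Subset n → ℕ → Bool
isHole []            _       = false
isHole (_ ∷ L)       (suc m) = isHole L m
isHole (inside ∷ _)  zero    = false
isHole (outside ∷ _) zero    = true

isHole-bounded : ∀ {n} (L : Subset n) {m} → isHole L m ≡ true → m < n
isHole-bounded (outside ∷ L) {zero}  _ = z<s
isHole-bounded (_ ∷ L)       {suc m} h = s≤s (isHole-bounded L h)

∉⇒isHole : ∀ {n} (L : Subset n) v → v ∉ L → isHole L (toℕ v) ≡ true
∉⇒isHole (inside ∷ L)  Fin.zero    v∉L = contradiction here v∉L
∉⇒isHole (outside ∷ L) Fin.zero    _   = refl
∉⇒isHole (_ ∷ L)       (Fin.suc v) v∉L = ∉⇒isHole L v (v∉L ∘ there)

isHole⇒∉ : ∀ {n} (L : Subset n) v → isHole L (toℕ v) ≡ true → v ∉ L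
isHole⇒∉ (inside ∷ L) Fin.zero    ()
isHole⇒∉ (_ ∷ L)      (Fin.suc v) h (there v∈L) = isHole⇒∉ L v h v∈L

HoleAt⇒isHole : ∀ {n} (L : Subset n) {m} → HoleAt L m → isHole L m ≡ true
HoleAt⇒isHole L (v , refl , v∉L) = ∉⇒isHole L v v∉L

isHole⇒HoleAt : ∀ {n} (L : Subset n) {m} → isHole L m ≡ true → HoleAt L m
isHole⇒HoleAt L h =
  fromℕ< m<n , toℕ≡ , isHole⇒∉ L _ (subst (λ q → isHole L q ≡ true) (sym toℕ≡) h)
  where
  m<n = isHole-bounded L h
  toℕ≡ = toℕ-fromℕ< m<n

countBelow-isHole : ∀ {n} (L : Subset n) → countBelow (isHole L) n + ∣ L ∣ ≡ n
countBelow-isHole []            = refl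
countBelow-isHole (inside ∷ L)  = trans (+-suc _ _) (cong suc (countBelow-isHole L))
countBelow-isHole (outside ∷ L) = cong suc (countBelow-isHole L)

landmark-separates-holes : ∀ {n k} {L : Subset n} → IsNLLandmarkSet n k L → ∣ L ∣ ≤ k →
  ∀ {τ u v} → τ ∈ L → u ∉ L → v ∉ L → u ≢ v → Separates τ u v
landmark-separates-holes {L = L} landmarks |L|≤k {τ} τ∈L u∉L v∉L u≢v
  with landmarks _ _ u∉L v∉L u≢v
... | S , S⊆L , k≤|S| , separates with τ ∈? S
...   | yes τ∈S = separates τ τ∈S
...   | no τ∉S = contradiction (≤-trans |L|≤k k≤|S|) (<⇒≱ (p⊂q⇒∣p∣<∣q∣ (S⊆L , τ , τ∈L , τ∉S)))

isHole-midpointConvex : ∀ {n k} {L : Subset n} → IsNLLandmarkSet n k L → ∣ L ∣ ≤ k →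
  ∀ {u v c} → u < v → isHole L u ≡ true → isHole L v ≡ true → u + v ≡ c + c → isHole L c ≡ true
isHole-midpointConvex {L = L} landmarks |L|≤k {c = c} u<v hu hv eq
  with isHole⇒HoleAt L hu | isHole⇒HoleAt L hv
... | x , refl , x∉L | y , refl , y∉L = HoleAt⇒isHole L (τ , toℕ≡ , τ∉L)
  where
  c<n = <-trans (midpoint<right u<v eq) (isHole-bounded L hv)
  τ = fromℕ< c<n
  toℕ≡ = toℕ-fromℕ< c<n
  τ∉L : τ ∉ L
  τ∉L τ∈L = landmark-separates-holes landmarks |L|≤k τ∈L x∉L y∉L
    (λ x≡y → <-irrefl (cong toℕ x≡y) u<v)
    (midpoint-equidistant {toℕ x} {toℕ y} {toℕ τ} (trans eq (cong₂ _+_ (sym toℕ≡) (sym toℕ≡))))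

LandmarkBetweenHoles : ∀ {n} → Subset n → Set
LandmarkBetweenHoles L = ∃[ u ] ∃[ w ] ∃[ v ] (u < w × w < v × HoleAt L u × ¬ HoleAt L w × HoleAt L v)

gap-end-unique : ∀ {n} {L : Subset n} {a b b′} → IsGap L a b → IsGap L a b′ → b ≡ b′
gap-end-unique {b = b} {b′} (a≤b , holes , _ , afterEnd) (a≤b′ , holes′ , _ , afterEnd′)
  with <-cmp b b′
... | tri< b<b′ _ _ = contradiction (holes′ (suc b) (m≤n⇒m≤1+n a≤b) b<b′) afterEnd
... | tri≈ _ b≡b′ _ = b≡b′
... | tri> _ _ b′<b = contradiction (holes (suc b′) (m≤n⇒m≤1+n a≤b′) b′<b) afterEnd′

earlier-gap⇒landmarkBetweenHoles : ∀ {n} {L : Subset n} {a b a′ b′} →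
  IsGap L a b → IsGap L a′ b′ → a < a′ → LandmarkBetweenHoles L
earlier-gap⇒landmarkBetweenHoles {a = a} (a≤b , holes , _ , _) (a′≤b′ , holes′ , beforeStart′ , _)
  (s≤s {n = w} a≤w) =
  a , w , suc w , a<w , ≤-refl , hole-a , beforeStart′ w refl , holes′ (suc w) ≤-refl a′≤b′
  where
  hole-a = holes a ≤-refl a≤b
  a<w = ≤∧≢⇒< a≤w λ { refl → beforeStart′ a refl hole-a }

twoGaps⇒landmarkBetweenHoles : ∀ {n} {L : Subset n} → AtLeastTwoGaps L → LandmarkBetweenHoles L
twoGaps⇒landmarkBetweenHoles (a , b , a′ , b′ , gap , gap′ , distinct) with <-cmp a a′
... | tri< a<a′ _ _ = earlier-gap⇒landmarkBetweenHoles gap gap′ a<a′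
... | tri≈ _ refl _ = contradiction (refl , gap-end-unique gap gap′) distinct
... | tri> _ _ a′<a = earlier-gap⇒landmarkBetweenHoles gap′ gap a′<a

holes-as-progression : ∀ {n a ρ N} (L : Subset n) → IsArithmeticProgression (isHole L) a ρ N →
  (v : Fin n) → (v ∉ L) ⇔ (∃[ j ] (j < N × suc (toℕ v) ≡ suc a + j * ρ))
holes-as-progression L progression v = mk⇔
  (λ v∉L → let (j , j<N , v≡) = to (∉⇒isHole L v v∉L) in j , j<N , cong suc v≡)
  (λ (j , j<N , v≡) → isHole⇒∉ L v (from (j , j<N , suc-injective v≡)))
  where open Equivalence (progression (toℕ v))

progression-length-bound : ∀ M k → M * 3 < suc M + k → 2 * (suc M + k) ≤ 3 * k + 2
progression-length-bound M k (s≤s 3M≤M+k) = begin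
  2 * (suc M + k)      ≡⟨ expand M k ⟩
  M * 2 + (2 + 2 * k)  ≤⟨ +-monoˡ-≤ (2 + 2 * k) 2M≤k ⟩
  k + (2 + 2 * k)      ≡⟨ collect k ⟩
  3 * k + 2            ∎
  where
  open ≤-Reasoning
  expand : ∀ M k → 2 * (suc M + k) ≡ M * 2 + (2 + 2 * k)
  expand = solve-∀
  collect : ∀ k → k + (2 + 2 * k) ≡ 3 * k + 2
  collect = solve-∀
  split : ∀ M → M * 3 ≡ M + M * 2
  split = solve-∀
  2M≤k : M * 2 ≤ k
  2M≤k = +-cancelˡ-≤ M (M * 2) k (subst (_≤ M + k) (split M) 3M≤M+k)

holes-form-progression : ∀ {n k} {L : Subset n} →
  IsNLLandmarkSet n k L → ∣ L ∣ ≡ k → AtLeastTwoGaps L →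
  ∃[ a ] ∃[ ρ ] ∃[ M ]
    (3 ≤ ρ × ρ % 2 ≡ 1 × IsArithmeticProgression (isHole L) a ρ (suc M) × suc M + k ≡ n)
holes-form-progression {n} {L = L} landmarks |L|≡k twoGaps
  with twoGaps⇒landmarkBetweenHoles twoGaps
... | u , w , v , u<w , w<v , hole-u , landmark-w , hole-v
  with MidpointConvex.progression-around-gap (isHole L) n (isHole-bounded L)
         (isHole-midpointConvex landmarks (≤-reflexive |L|≡k))
         u<w w<v (HoleAt⇒isHole L hole-u) (¬-not (landmark-w ∘ isHole⇒HoleAt L)) (HoleAt⇒isHole L hole-v)
... | a , ρ , M , 3≤ρ , odd , progression , count =
  a , ρ , M , 3≤ρ , odd , progression , trans (cong₂ _+_ (sym count) (sym |L|≡k)) (countBelow-isHole L)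

mainTheorem5 : (n k : ℕ) → 2 ≤ k → k + 2 ≤ n → (L : Subset n) →
    IsNLLandmarkSet n k L → ∣ L ∣ ≡ k → AtLeastTwoGaps L →
    (∃[ i ] ∃[ ρ ] (3 ≤ ρ × ρ % 2 ≡ 1 × 1 ≤ i × i + (n ∸ k ∸ 1) * ρ ≤ n
      × ((v : Fin n) → (v ∉ L) ⇔ (∃[ j ] (j < n ∸ k × suc (toℕ v) ≡ i + j * ρ)))))
    × 2 * n ≤ 3 * k + 2
mainTheorem5 n k _ _ L landmarks |L|≡k twoGaps with holes-form-progression landmarks |L|≡k twoGaps
... | a , ρ , M , 3≤ρ , odd , progression , 1+M+k≡n =
  (suc a , ρ , 3≤ρ , odd , s≤s z≤n , fits , holes) ,
  subst (λ m → 2 * m ≤ 3 * k + 2) 1+M+k≡n (progression-length-bound M k 3M<1+M+k)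
  where
  n∸k≡1+M : n ∸ k ≡ suc M
  n∸k≡1+M = trans (cong (_∸ k) (sym 1+M+k≡n)) (m+n∸n≡m (suc M) k)
  last<n : a + M * ρ < n
  last<n = isHole-bounded L (Equivalence.from (progression _) (M , ≤-refl , refl))
  fits : suc a + (n ∸ k ∸ 1) * ρ ≤ n
  fits = subst (λ N → suc a + (N ∸ 1) * ρ ≤ n) (sym n∸k≡1+M) last<n
  holes : (x : Fin n) → (x ∉ L) ⇔ (∃[ j ] (j < n ∸ k × suc (toℕ x) ≡ suc a + j * ρ))
  holes = subst (λ N → (x : Fin n) → (x ∉ L) ⇔ (∃[ j ] (j < N × suc (toℕ x) ≡ suc a + j * ρ)))
    (sym n∸k≡1+M) (holes-as-progression L progression)
  3M<1+M+k : M * 3 < suc M + k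
  3M<1+M+k = ≤-<-trans (≤-trans (*-monoʳ-≤ M 3≤ρ) (m≤n+m (M * ρ) a))
    (subst (a + M * ρ <_) (sym 1+M+k≡n) last<n)
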